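{- Let $L\subseteq\mathcal{L}$ be a finite signature, $h\in L$, $\mu\in\mathbb{M}(L)$ and $T\subseteq\mathbb{M}(L)$. If $\mathsf{rmv}_h(\mu)\in\mathsf{rmv}_h(T)$ and $\mu_{|h}=\varepsilon$, then $\mu\in\overline{T}$.
   Context: Fix a universe $\mathcal{L}$ of lifelines and a universe $\mathcal{M}$ of messages. For $l\in\mathcal{L}$, $\mathbb{A}_l=\{l!m,\ l?m\mid m\in\mathcal{M}\}$ and $\mathbb{T}_l=\mathbb{A}_l^*$, with empty word $\varepsilon$. For finite $L\subseteq\mathcal{L}$, $\mathbb{M}(L)=\prod_{l\in L}\mathbb{T}_l$ is the set of multi-traces, and $\mu_{|l}$ denotes the $l$-component of $\mu$. For $h\in L$, $\mathsf{rmv}_h(\mu)=(\mu_{|l})_{l\in L\setminus\{h\}}\in\mathbb{M}(L\setminus\{h\})$, and $\mathsf{rmv}_h(T)=\{\mathsf{rmv}_h(\mu)\mid\mu\in T\}$. The set of multi-prefixes of $T$ is \[\overline{T}=\{\mu'\in\mathbb{M}(L)\mid\exists\mu\in T\ \forall l\in L,\ \mu'_{|l}\text{ is a prefix of }\mu_{|l}\}.\] -}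

module Defs where

open import Data.List using (List; []; _++_)
open import Data.List.Membership.Propositional using (_∈_)
open import Data.List.Relation.Unary.Unique.Propositional using (Unique)
open import Data.Product using (Σ; ∃; _×_; _,_)
open import Relation.Binary.PropositionalEquality using (_≡_)
open import Relation.Nullary using (¬_)

module Interactions (Lifeline : Set) (Message : Set) where

  data Action (l : Lifeline) : Set where
    emit : Message → Action l
    recv : Message → Action l

  Trace : Lifeline → Set
  Trace l = List (Action l)

  ε : ∀ {l} → Trace l
  ε = []

  record Signature : Set where
    field
      lifelines : List Lifeline
      unique    : Unique lifelines
  open Signature public

  MultiTrace : Signature → Set
  MultiTrace L = (l : Lifeline) → l ∈ lifelines L → Trace l

  MultiTraceWithout : Signature → Lifeline → Set
  MultiTraceWithout L h = (l : Lifeline) → l ∈ lifelines L → ¬ (l ≡ h) → Trace l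

  MTSet : Signature → Set₁
  MTSet L = MultiTrace L → Set

  proj : ∀ {L} → MultiTrace L → (l : Lifeline) → l ∈ lifelines L → Trace l
  proj μ = μ

  rmv : ∀ {L} (h : Lifeline) → MultiTrace L → MultiTraceWithout L h
  rmv h μ l l∈L _ = μ l l∈L

  _≈ʷ_ : ∀ {L h} → MultiTraceWithout L h → MultiTraceWithout L h → Set
  _≈ʷ_ {L} {h} ν ν' = ∀ l (l∈L : l ∈ lifelines L) (l≢h : ¬ (l ≡ h)) → ν l l∈L l≢h ≡ ν' l l∈L l≢h

  InRmv : (L : Signature) (h : Lifeline) → MTSet L → MultiTraceWithout L h → Set
  InRmv L h T ν = Σ (MultiTrace L) λ μ → T μ × (_≈ʷ_ {L} {h} (rmv {L} h μ) ν)

  IsPrefix : ∀ {l} → Trace l → Trace l → Set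
  IsPrefix u v = ∃ λ w → u ++ w ≡ v

  MultiPrefixes : ∀ {L} → MTSet L → MTSet L
  MultiPrefixes {L} T μ' =
    Σ (MultiTrace L) λ μ → T μ × (∀ l (l∈L : l ∈ lifelines L) → IsPrefix (μ' l l∈L) (μ l l∈L))

{-# OPTIONS --safe #-}
module Submission where

open import Defs
open import Data.List using (List; []; _∷_)
open import Data.List.Membership.Propositional using (_∈_)
open import Data.List.Properties using (++-identityʳ)
open import Data.List.Relation.Unary.All using (lookup)
open import Data.List.Relation.Unary.Any using (here; there)
open import Data.List.Relation.Unary.Unique.Propositional using (Unique; _∷_)
open import Data.Product using (_,_)
open import Relation.Binary.PropositionalEquality using (_≡_; _≢_; refl; sym)

-- Without decidable equality on the carrier, duplicate-freeness is what lets us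
-- tell the component h apart from every other one.
data SameOrDistinct {A : Set} {xs : List A} {h : A} (h∈xs : h ∈ xs) : (l : A) → l ∈ xs → Set where
  same     : SameOrDistinct h∈xs h h∈xs
  distinct : ∀ {l} {l∈xs : l ∈ xs} → l ≢ h → SameOrDistinct h∈xs l l∈xs

sameOrDistinct-there : ∀ {A : Set} {x : A} {xs h l} {h∈xs : h ∈ xs} {l∈xs : l ∈ xs} →
  SameOrDistinct h∈xs l l∈xs → SameOrDistinct {xs = x ∷ xs} (there h∈xs) l (there l∈xs)
sameOrDistinct-there same           = same
sameOrDistinct-there (distinct l≢h) = distinct l≢h

sameOrDistinct : ∀ {A : Set} {xs : List A} {h l} → Unique xs →
  (h∈xs : h ∈ xs) (l∈xs : l ∈ xs) → SameOrDistinct h∈xs l l∈xs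
sameOrDistinct _         (here refl) (here refl) = same
sameOrDistinct (x∉ ∷ _)  (here refl) (there l∈) = distinct (λ l≡x → lookup x∉ l∈ (sym l≡x))
sameOrDistinct (x∉ ∷ _)  (there h∈) (here refl) = distinct (lookup x∉ h∈)
sameOrDistinct (_  ∷ un) (there h∈) (there l∈) = sameOrDistinct-there (sameOrDistinct un h∈ l∈)

module _ (Lifeline Message : Set) where
  open Interactions Lifeline Message

  ≡⇒isPrefix : ∀ {l} {u v : Trace l} → u ≡ v → IsPrefix u v
  ≡⇒isPrefix refl = [] , ++-identityʳ _

  ε-isPrefix : ∀ {l} (u : Trace l) → IsPrefix ε u
  ε-isPrefix u = u , refl

  isPrefix-of-agreeing-off : ∀ {L h} (h∈L : h ∈ lifelines L) (μ ν : MultiTrace L) →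
    _≈ʷ_ {L} {h} (rmv {L} h ν) (rmv {L} h μ) → μ h h∈L ≡ ε →
    ∀ l (l∈L : l ∈ lifelines L) → IsPrefix (μ l l∈L) (ν l l∈L)
  isPrefix-of-agreeing-off {L} h∈L μ ν ν≈μ μₕ≡ε l l∈L = by (sameOrDistinct (unique L) h∈L l∈L)
    where
    by : SameOrDistinct h∈L l l∈L → IsPrefix (μ l l∈L) (ν l l∈L)
    by same rewrite μₕ≡ε = ε-isPrefix (ν l l∈L)
    by (distinct l≢h)    = ≡⇒isPrefix {l} (sym (ν≈μ l l∈L l≢h))

mainTheorem5 : (Lifeline Message : Set) → let open Interactions Lifeline Message in
    (L : Signature) (h : Lifeline) (h∈L : h ∈ lifelines L) (μ : MultiTrace L) (T : MTSet L) →
    InRmv L h T (rmv {L} h μ) → μ h h∈L ≡ ε → MultiPrefixes {L} T μ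
mainTheorem5 Lifeline Message L h h∈L μ T (ν , ν∈T , ν≈μ) μₕ≡ε =
  ν , ν∈T , isPrefix-of-agreeing-off Lifeline Message {L} h∈L μ ν ν≈μ μₕ≡ε
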